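{- Let $G=K_n$ and let $J$ be the matching with edge set $\{(i,i') : 1\le i\le n\}$. Then $\Phi(G^k)\ge \frac{n}{2}$ for all $k\ge 1$.
   Context: Let $G=K_n$ with vertex set $\{v_1,\dots,v_n\}$, and $K_{n,n}$ the complete bipartite graph with parts $\{1,\dots,n\}$ and $\{1',\dots,n'\}$. The self-similar graphs based on $(G,J)$: $G^1=G$; for $k\ge2$, $V(G^k)=V(G)^k$, and $(v_{i_1},\dots,v_{i_k})\sim(v_{j_1},\dots,v_{j_k})$ in $G^k$ iff either (1) $(v_{i_1},\dots,v_{i_{k-1}})=(v_{j_1},\dots,v_{j_{k-1}})$ and $v_{i_k}\sim v_{j_k}$ in $G$, or (2) $(v_{i_1},\dots,v_{i_{k-1}})\sim(v_{j_1},\dots,v_{j_{k-1}})$ in $G^{k-1}$ and $i_k\sim j_k'$ in $J$. The conductance (edge expansion coefficient) of a graph $H$ is $\Phi(H)=\min \frac{\delta_H(S)}{|S|}$ over all non-empty $S\subseteq V(H)$ with $|S|\le |V(H)|/2$, where $\delta_H(S)$ is the number of edges joining $S$ to $V(H)\setminus S$. -}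

module Defs where

open import Data.Nat using (ℕ; zero; suc; _+_; _*_; _≤_)
open import Data.Bool using (Bool; true; false; _∧_; _∨_; not; if_then_else_)
open import Data.Fin using (Fin)
open import Data.Fin.Properties using () renaming (_≟_ to _≟F_)
open import Data.Unit using (⊤; tt)
open import Data.Product using (_×_; _,_)
open import Data.List using (List; []; _∷_; map; concatMap; allFin; length; filter)
open import Data.Nat.ListAction using (sum)
open import Relation.Nullary.Decidable using (⌊_⌋)
open import Relation.Binary.PropositionalEquality using (_≡_)

record FinGraph : Set₁ where
  field
    V     : Set
    verts : List V          -- enumeration of V (each vertex exactly once)
    adj   : V → V → Bool

open FinGraph public

count : {A : Set} → (A → Bool) → List A → ℕ
count p []       = 0
count p (x ∷ xs) = (if p x then 1 else 0) + count p xs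

card : (H : FinGraph) → (V H → Bool) → ℕ
card H S = count S (verts H)

-- δ_H(S): number of edges joining S to V(H) \ S; each such edge {u,v}
-- is counted exactly once as the ordered pair (u ∈ S, v ∉ S).
boundary : (H : FinGraph) → (V H → Bool) → ℕ
boundary H S =
  sum (map (λ u → if S u
                    then count (λ v → not (S v) ∧ adj H u v) (verts H)
                    else 0)
           (verts H))

-- Φ(H) ≥ p / q  (q > 0): for every non-empty S with |S| ≤ |V(H)|/2,
-- δ_H(S)/|S| ≥ p/q, i.e. p·|S| ≤ q·δ_H(S).
ConductanceAtLeast : (H : FinGraph) → (p q : ℕ) → Set
ConductanceAtLeast H p q =
  (S : V H → Bool) → 1 ≤ card H S → 2 * card H S ≤ length (verts H) →
  p * card H S ≤ q * boundary H S

-- Self-similar graphs G^k based on (G, J), G on vertex set Fin n,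
-- J ⊆ K_{n,n} given by j i j' = true iff i ∼ j' in J.
-- V(G^k) = V(G)^k, realised as ((⊤ × Fin n) × Fin n) … × Fin n
-- (k factors Fin n); the last component is the k-th coordinate.

Tup : ℕ → ℕ → Set
Tup n zero    = ⊤
Tup n (suc k) = Tup n k × Fin n

tups : (n k : ℕ) → List (Tup n k)
tups n zero    = tt ∷ []
tups n (suc k) = concatMap (λ t → map (λ a → (t , a)) (allFin n)) (tups n k)

eqTup : (n k : ℕ) → Tup n k → Tup n k → Bool
eqTup n zero    _       _       = true
eqTup n (suc k) (s , a) (t , b) = eqTup n k s t ∧ ⌊ a ≟F b ⌋

-- Adjacency of G^k.  For k = 1 this reduces to adjacency in G
-- (the prefix is the unique element of ⊤); k = 0 is never used.
ssAdj : (n : ℕ) → (g j : Fin n → Fin n → Bool) → (k : ℕ) →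
        Tup n k → Tup n k → Bool
ssAdj n g j zero    _       _       = false
ssAdj n g j (suc k) (s , a) (t , b) =
  (eqTup n k s t ∧ g a b) ∨ (ssAdj n g j k s t ∧ j a b)

selfSimilar : (n : ℕ) → (g j : Fin n → Fin n → Bool) → ℕ → FinGraph
selfSimilar n g j k = record
  { V = Tup n k ; verts = tups n k ; adj = ssAdj n g j k }

completeAdj : (n : ℕ) → Fin n → Fin n → Bool
completeAdj n a b = not ⌊ a ≟F b ⌋

matchingJ : (n : ℕ) → Fin n → Fin n → Bool
matchingJ n a b = ⌊ a ≟F b ⌋

-- Write N = n^k.  The heart is the isoperimetric inequality n·|S|·|Sᶜ| ≤ N·δ(S)
-- for all S ⊆ V(G^k); for k = 1 it is the identity δ(S) = |S|·|Sᶜ| in K_n.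
-- Inductively, a pair (s,a) ∈ S, (t,b) ∉ S is separated either between (s,a)
-- and (t,a), i.e. inside the fibre S_a = {s | (s,a) ∈ S} ⊆ V(G^(k-1)), or between
-- (t,a) and (t,b), i.e. inside a copy of K_n.  The first kind is controlled by
-- the induction hypothesis on each fibre and the matching edges (s,a)(t,a); the
-- second kind are themselves edges of G^k.  Finally |S| ≤ N/2 forces
-- |Sᶜ| ≥ N/2, which turns the isoperimetric inequality into n·|S| ≤ 2·δ(S).

module Submission where

open import Defs
open import Data.Bool using (Bool; true; false; _∧_; _∨_; not; if_then_else_)
open import Data.Fin using (Fin)
open import Data.Fin.Properties using () renaming (_≟_ to _≟F_)
open import Data.List using (List; []; _∷_; _++_; map; concatMap; allFin; length)
open import Data.List.Membership.Propositional using (_∈_)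
open import Data.List.Membership.Propositional.Properties using (∈-allFin; ∈-map⁺; ∈-concatMap⁺)
open import Data.List.Properties using (map-++; map-∘; length-tabulate)
open import Data.List.Relation.Unary.Any as Any using (here; there)
open import Data.Nat using (ℕ; zero; suc; _+_; _*_; _^_; _≤_; _<_; z≤n; s≤s; >-nonZero)
open import Data.Nat.ListAction using (sum)
open import Data.Nat.ListAction.Properties using (sum-++)
open import Data.Nat.Properties
open import Algebra.Properties.CommutativeSemigroup +-commutativeSemigroup
  using () renaming (interchange to +-interchange)
open import Data.Nat.Tactic.RingSolver using (solve-∀)
open import Data.Product using (_,_)
open import Data.Unit using (tt)
open import Function using (_∘_)
open import Relation.Nullary using (yes; no; contradiction)
open import Relation.Nullary.Decidable using (⌊_⌋)
open import Relation.Binary.PropositionalEquality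

private variable
  A B : Set

𝟙 : Bool → ℕ
𝟙 b = if b then 1 else 0

∑ : List A → (A → ℕ) → ℕ
∑ xs f = sum (map f xs)

syntax ∑ xs (λ x → e) = ∑[ x ∈ xs ] e

∑-cong : (xs : List A) {f g : A → ℕ} → (∀ x → f x ≡ g x) → ∑ xs f ≡ ∑ xs g
∑-cong []       f≡g = refl
∑-cong (x ∷ xs) f≡g = cong₂ _+_ (f≡g x) (∑-cong xs f≡g)

∑-mono : (xs : List A) {f g : A → ℕ} → (∀ x → f x ≤ g x) → ∑ xs f ≤ ∑ xs g
∑-mono []       f≤g = z≤n
∑-mono (x ∷ xs) f≤g = +-mono-≤ (f≤g x) (∑-mono xs f≤g)

∑-distrib-+ : (xs : List A) (f g : A → ℕ) → ∑[ x ∈ xs ] (f x + g x) ≡ ∑ xs f + ∑ xs g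
∑-distrib-+ []       f g = refl
∑-distrib-+ (x ∷ xs) f g = trans (cong (f x + g x +_) (∑-distrib-+ xs f g))
                                 (+-interchange (f x) (g x) (∑ xs f) (∑ xs g))

∑-distribˡ-* : (xs : List A) (c : ℕ) (f : A → ℕ) → c * ∑ xs f ≡ ∑[ x ∈ xs ] (c * f x)
∑-distribˡ-* []       c f = *-zeroʳ c
∑-distribˡ-* (x ∷ xs) c f = trans (*-distribˡ-+ c (f x) (∑ xs f)) (cong (c * f x +_) (∑-distribˡ-* xs c f))

∑-*-∑ : (xs : List A) (ys : List B) (f : A → ℕ) (g : B → ℕ) →
        ∑ xs f * ∑ ys g ≡ ∑[ x ∈ xs ] ∑[ y ∈ ys ] (f x * g y)
∑-*-∑ xs ys f g = begin
  ∑ xs f * ∑ ys g                    ≡⟨ *-comm (∑ xs f) (∑ ys g) ⟩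
  ∑ ys g * ∑ xs f                    ≡⟨ ∑-distribˡ-* xs (∑ ys g) f ⟩
  ∑[ x ∈ xs ] (∑ ys g * f x)         ≡⟨ ∑-cong xs (λ x → *-comm (∑ ys g) (f x)) ⟩
  ∑[ x ∈ xs ] (f x * ∑ ys g)         ≡⟨ ∑-cong xs (λ x → ∑-distribˡ-* ys (f x) g) ⟩
  ∑[ x ∈ xs ] ∑[ y ∈ ys ] (f x * g y) ∎
  where open ≡-Reasoning

∑-const : (xs : List A) (c : ℕ) → ∑[ x ∈ xs ] c ≡ length xs * c
∑-const []       c = refl
∑-const (x ∷ xs) c = cong (c +_) (∑-const xs c)

∑-zero : (xs : List A) → ∑[ x ∈ xs ] 0 ≡ 0
∑-zero xs = trans (∑-const xs 0) (*-zeroʳ (length xs))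

∑-comm : (xs : List A) (ys : List B) (f : A → B → ℕ) →
         ∑[ x ∈ xs ] ∑[ y ∈ ys ] f x y ≡ ∑[ y ∈ ys ] ∑[ x ∈ xs ] f x y
∑-comm []       ys f = sym (∑-zero ys)
∑-comm (x ∷ xs) ys f = trans (cong (∑ ys (f x) +_) (∑-comm xs ys f))
                             (sym (∑-distrib-+ ys (f x) (λ y → ∑[ x′ ∈ xs ] f x′ y)))

∑-map : (g : A → B) (xs : List A) (f : B → ℕ) → ∑ (map g xs) f ≡ ∑[ x ∈ xs ] f (g x)
∑-map g xs f = cong sum (sym (map-∘ xs))

∑-concatMap : (g : A → List B) (xs : List A) (f : B → ℕ) →
              ∑ (concatMap g xs) f ≡ ∑[ x ∈ xs ] ∑ (g x) f
∑-concatMap g []       f = refl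
∑-concatMap g (x ∷ xs) f = begin
  sum (map f (g x ++ concatMap g xs))         ≡⟨ cong sum (map-++ f (g x) (concatMap g xs)) ⟩
  sum (map f (g x) ++ map f (concatMap g xs)) ≡⟨ sum-++ (map f (g x)) _ ⟩
  ∑ (g x) f + ∑ (concatMap g xs) f            ≡⟨ cong (∑ (g x) f +_) (∑-concatMap g xs f) ⟩
  ∑ (g x) f + ∑[ x′ ∈ xs ] ∑ (g x′) f         ∎
  where open ≡-Reasoning

∈⇒≤∑ : {xs : List A} {x : A} (f : A → ℕ) → x ∈ xs → f x ≤ ∑ xs f
∈⇒≤∑ f (here refl) = m≤m+n _ _
∈⇒≤∑ f (there x∈) = ≤-trans (∈⇒≤∑ f x∈) (m≤n+m _ _)

length≡∑1 : (xs : List A) → length xs ≡ ∑[ x ∈ xs ] 1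
length≡∑1 xs = sym (trans (∑-const xs 1) (*-identityʳ (length xs)))

𝟙-disjoint : ∀ b → 𝟙 b * 𝟙 (not b) ≡ 0
𝟙-disjoint true  = refl
𝟙-disjoint false = refl

𝟙-partition : ∀ b → 𝟙 b + 𝟙 (not b) ≡ 1
𝟙-partition true  = refl
𝟙-partition false = refl

≟-refl : ∀ {n} (a : Fin n) → ⌊ a ≟F a ⌋ ≡ true
≟-refl a with a ≟F a
... | yes _  = refl
... | no a≢a = contradiction refl a≢a

count≡∑ : (p : A → Bool) (xs : List A) → count p xs ≡ ∑[ x ∈ xs ] 𝟙 (p x)
count≡∑ p []       = refl
count≡∑ p (x ∷ xs) = cong (𝟙 (p x) +_) (count≡∑ p xs)

size : (H : FinGraph) → (V H → Bool) → ℕ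
size H S = ∑[ u ∈ verts H ] 𝟙 (S u)

cut : (H : FinGraph) → (V H → Bool) → ℕ
cut H S = ∑[ u ∈ verts H ] ∑[ v ∈ verts H ] (𝟙 (S u) * 𝟙 (not (S v) ∧ adj H u v))

card≡size : (H : FinGraph) (S : V H → Bool) → card H S ≡ size H S
card≡size H S = count≡∑ S (verts H)

size+size-compl : (H : FinGraph) (S : V H → Bool) → size H S + size H (not ∘ S) ≡ length (verts H)
size+size-compl H S = begin
  size H S + size H (not ∘ S)                 ≡⟨ ∑-distrib-+ (verts H) _ _ ⟨
  ∑[ u ∈ verts H ] (𝟙 (S u) + 𝟙 (not (S u))) ≡⟨ ∑-cong (verts H) (𝟙-partition ∘ S) ⟩
  ∑[ u ∈ verts H ] 1                          ≡⟨ length≡∑1 (verts H) ⟨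
  length (verts H)                            ∎
  where open ≡-Reasoning

boundary≡cut : (H : FinGraph) (S : V H → Bool) → boundary H S ≡ cut H S
boundary≡cut H S = ∑-cong (verts H) out-edges
  where
  out-edges : ∀ u → (if S u then count (λ v → not (S v) ∧ adj H u v) (verts H) else 0)
                  ≡ ∑[ v ∈ verts H ] (𝟙 (S u) * 𝟙 (not (S v) ∧ adj H u v))
  out-edges u with S u
  ... | true  = trans (count≡∑ _ (verts H)) (∑-cong (verts H) (λ v → sym (*-identityˡ _)))
  ... | false = sym (∑-zero (verts H))

conductance-from-isoperimetry : ∀ n {m m′ N D} → n * (m * m′) ≤ N * D →
                                m + m′ ≡ N → 2 * m ≤ N → 1 ≤ m → n * m ≤ 2 * D
conductance-from-isoperimetry n {m} {m′} {N} {D} iso m+m′≡N 2m≤N 1≤m =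
  *-cancelˡ-≤ N {{>-nonZero 0<N}} (begin
    N * (n * m)          ≡⟨ cong (_* (n * m)) m+m′≡N ⟨
    (m + m′) * (n * m)   ≤⟨ *-monoˡ-≤ (n * m) (+-monoˡ-≤ m′ m≤m′) ⟩
    (m′ + m′) * (n * m)  ≡⟨ regroupˡ n m m′ ⟩
    2 * (n * (m * m′))   ≤⟨ *-monoʳ-≤ 2 iso ⟩
    2 * (N * D)          ≡⟨ regroupʳ N D ⟩
    N * (2 * D)          ∎)
  where
  open ≤-Reasoning
  m≤m′ : m ≤ m′
  m≤m′ = +-cancelˡ-≤ m m m′ (subst₂ _≤_ (cong (m +_) (+-identityʳ m)) (sym m+m′≡N) 2m≤N)
  0<N : 0 < N
  0<N = ≤-trans 1≤m (subst (m ≤_) m+m′≡N (m≤m+n m m′))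
  regroupˡ : ∀ n m m′ → (m′ + m′) * (n * m) ≡ 2 * (n * (m * m′))
  regroupˡ = solve-∀
  regroupʳ : ∀ N D → 2 * (N * D) ≡ N * (2 * D)
  regroupʳ = solve-∀

crossing-triangle : ∀ x y z → 𝟙 x * 𝟙 (not y) ≤ 𝟙 x * 𝟙 (not z) + 𝟙 z * 𝟙 (not y)
crossing-triangle false y     z     = z≤n
crossing-triangle true  true  z     = z≤n
crossing-triangle true  false false = s≤s z≤n
crossing-triangle true  false true  = s≤s z≤n

crossing-split : ∀ x y e r c →
  𝟙 x * 𝟙 (not y ∧ ((e ∧ not c) ∨ (r ∧ c))) ≡ 𝟙 x * 𝟙 (not y) * 𝟙 (e ∧ not c) + 𝟙 x * 𝟙 (not y ∧ r) * 𝟙 c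
crossing-split false y     e     r     c     = refl
crossing-split true  true  e     r     c     = refl
crossing-split true  false false false false = refl
crossing-split true  false false false true  = refl
crossing-split true  false false true  false = refl
crossing-split true  false false true  true  = refl
crossing-split true  false true  false false = refl
crossing-split true  false true  false true  = refl
crossing-split true  false true  true  false = refl
crossing-split true  false true  true  true  = refl

module Isoperimetry (n : ℕ) where

  G : ℕ → FinGraph
  G = selfSimilar n (completeAdj n) (matchingJ n)

  length-allFin : length (allFin n) ≡ n
  length-allFin = length-tabulate (λ a → a)

  ∈-tups : ∀ k (s : Tup n k) → s ∈ tups n k
  ∈-tups zero    tt      = here refl
  ∈-tups (suc k) (s , a) = ∈-concatMap⁺ (λ t → map (t ,_) (allFin n))
    (Any.map (λ { refl → ∈-map⁺ (s ,_) (∈-allFin a) }) (∈-tups k s))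

  ∑-tups-suc : ∀ k (f : Tup n (suc k) → ℕ) →
               ∑ (tups n (suc k)) f ≡ ∑[ s ∈ tups n k ] ∑[ a ∈ allFin n ] f (s , a)
  ∑-tups-suc k f = trans (∑-concatMap _ (tups n k) f) (∑-cong (tups n k) (λ s → ∑-map (s ,_) (allFin n) f))

  length-tups : ∀ k → length (tups n k) ≡ n ^ k
  length-tups zero    = refl
  length-tups (suc k) = begin
    length (tups n (suc k))                     ≡⟨ length≡∑1 (tups n (suc k)) ⟩
    ∑[ u ∈ tups n (suc k) ] 1                   ≡⟨ ∑-tups-suc k _ ⟩
    ∑[ s ∈ tups n k ] ∑[ a ∈ allFin n ] 1       ≡⟨ ∑-cong (tups n k) (λ _ → length≡∑1 (allFin n)) ⟨
    ∑[ s ∈ tups n k ] length (allFin n)         ≡⟨ ∑-const (tups n k) _ ⟩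
    length (tups n k) * length (allFin n)       ≡⟨ cong₂ _*_ (length-tups k) length-allFin ⟩
    n ^ k * n                                   ≡⟨ *-comm (n ^ k) n ⟩
    n ^ suc k                                   ∎
    where open ≡-Reasoning

  eqTup-refl : ∀ k (s : Tup n k) → eqTup n k s s ≡ true
  eqTup-refl zero    tt      = refl
  eqTup-refl (suc k) (s , a) rewrite eqTup-refl k s | ≟-refl a = refl

  ∑⁴ : ∀ k → (Tup n k → Fin n → Tup n k → Fin n → ℕ) → ℕ
  ∑⁴ k f = ∑[ s ∈ tups n k ] ∑[ a ∈ allFin n ] ∑[ t ∈ tups n k ] ∑[ b ∈ allFin n ] f s a t b

  module _ (k : ℕ) where
    private
      T = tups n k
      F = allFin n

    ∑²-tups-suc : (f : Tup n (suc k) → Tup n (suc k) → ℕ) →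
      ∑[ u ∈ tups n (suc k) ] ∑[ v ∈ tups n (suc k) ] f u v ≡ ∑⁴ k (λ s a t b → f (s , a) (t , b))
    ∑²-tups-suc f = trans (∑-tups-suc k _) (∑-cong T λ s → ∑-cong F λ a → ∑-tups-suc k (f (s , a)))

    ∑⁴-cong : ∀ {f g} → (∀ s a t b → f s a t b ≡ g s a t b) → ∑⁴ k f ≡ ∑⁴ k g
    ∑⁴-cong f≡g = ∑-cong T λ s → ∑-cong F λ a → ∑-cong T λ t → ∑-cong F (f≡g s a t)

    ∑⁴-mono : ∀ {f g} → (∀ s a t b → f s a t b ≤ g s a t b) → ∑⁴ k f ≤ ∑⁴ k g
    ∑⁴-mono f≤g = ∑-mono T λ s → ∑-mono F λ a → ∑-mono T λ t → ∑-mono F (f≤g s a t)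

    ∑⁴-distrib-+ : ∀ f g → ∑⁴ k (λ s a t b → f s a t b + g s a t b) ≡ ∑⁴ k f + ∑⁴ k g
    ∑⁴-distrib-+ f g =
      trans (∑-cong T λ s → trans (∑-cong F λ a → trans (∑-cong T λ t → ∑-distrib-+ F _ _)
                                                        (∑-distrib-+ T _ _))
                                  (∑-distrib-+ F _ _))
            (∑-distrib-+ T _ _)

  Isoperimetric : ℕ → Set
  Isoperimetric k = (S : Tup n k → Bool) → n * (size (G k) S * size (G k) (not ∘ S)) ≤ n ^ k * cut (G k) S

  module Step (k : ℕ) (S : Tup n (suc k) → Bool) where
    private
      T = tups n k
      F = allFin n

    fibre : Fin n → Tup n k → Bool
    fibre a s = S (s , a)

    In Out : Tup n k → Fin n → ℕ
    In  s a = 𝟙 (S (s , a))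
    Out t b = 𝟙 (not (S (t , b)))

    internal : ℕ
    internal = ∑[ t ∈ T ] ∑[ a ∈ F ] ∑[ b ∈ F ] (In t a * Out t b)

    Within Across : Tup n k → Fin n → Tup n k → Fin n → ℕ
    Within s a t b = In s a * Out t b * 𝟙 (eqTup n k s t ∧ not ⌊ a ≟F b ⌋)
    Across s a t b = In s a * 𝟙 (not (S (t , b)) ∧ adj (G k) s t) * 𝟙 ⌊ a ≟F b ⌋

    size*size-compl≡∑⁴ : size (G (suc k)) S * size (G (suc k)) (not ∘ S) ≡ ∑⁴ k (λ s a t b → In s a * Out t b)
    size*size-compl≡∑⁴ = trans (∑-*-∑ (tups n (suc k)) (tups n (suc k)) _ _) (∑²-tups-suc k _)

    ∑⁴-fibrewise : ∑⁴ k (λ s a t b → In s a * Out t a)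
                 ≡ n * ∑[ a ∈ F ] (size (G k) (fibre a) * size (G k) (not ∘ fibre a))
    ∑⁴-fibrewise = begin
      ∑⁴ k (λ s a t b → In s a * Out t a)
        ≡⟨ ∑-cong T (λ s → ∑-cong F λ a → ∑-cong T λ t →
             trans (∑-const F _) (cong (_* (In s a * Out t a)) length-allFin)) ⟩
      ∑[ s ∈ T ] ∑[ a ∈ F ] ∑[ t ∈ T ] (n * (In s a * Out t a))
        ≡⟨ ∑-comm T F _ ⟩
      ∑[ a ∈ F ] ∑[ s ∈ T ] ∑[ t ∈ T ] (n * (In s a * Out t a))
        ≡⟨ ∑-cong F (λ a → ∑-cong T λ s → ∑-distribˡ-* T n _) ⟨
      ∑[ a ∈ F ] ∑[ s ∈ T ] (n * ∑[ t ∈ T ] (In s a * Out t a))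
        ≡⟨ ∑-cong F (λ a → ∑-distribˡ-* T n _) ⟨
      ∑[ a ∈ F ] (n * ∑[ s ∈ T ] ∑[ t ∈ T ] (In s a * Out t a))
        ≡⟨ ∑-distribˡ-* F n _ ⟨
      n * ∑[ a ∈ F ] ∑[ s ∈ T ] ∑[ t ∈ T ] (In s a * Out t a)
        ≡⟨ cong (n *_) (∑-cong F λ a → ∑-*-∑ T T (λ s → In s a) (λ t → Out t a)) ⟨
      n * ∑[ a ∈ F ] (size (G k) (fibre a) * size (G k) (not ∘ fibre a))
        ∎
      where open ≡-Reasoning

    ∑⁴-rowwise : ∑⁴ k (λ s a t b → In t a * Out t b) ≡ n ^ k * internal
    ∑⁴-rowwise = trans (∑-cong T λ s → ∑-comm F T _)
                       (trans (∑-const T internal) (cong (_* internal) (length-tups k)))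

    cut≡within+across : cut (G (suc k)) S ≡ ∑⁴ k Within + ∑⁴ k Across
    cut≡within+across = trans (∑²-tups-suc k _)
      (trans (∑⁴-cong k λ s a t b →
                crossing-split (S (s , a)) (S (t , b)) (eqTup n k s t) (adj (G k) s t) ⌊ a ≟F b ⌋)
             (∑⁴-distrib-+ k Within Across))

    within-diagonal : ∀ s a b → In s a * Out s b ≡ Within s a s b
    within-diagonal s a b rewrite eqTup-refl k s with a ≟F b
    ... | no  _    = sym (*-identityʳ _)
    ... | yes refl = trans (𝟙-disjoint (S (s , a))) (sym (*-zeroʳ (In s a * Out s a)))

    internal≤within : internal ≤ ∑⁴ k Within
    internal≤within = ∑-mono T λ s → ∑-mono F λ a → begin
      ∑[ b ∈ F ] (In s a * Out s b)          ≡⟨ ∑-cong F (within-diagonal s a) ⟩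
      ∑[ b ∈ F ] Within s a s b              ≤⟨ ∈⇒≤∑ (λ t → ∑ F (Within s a t)) (∈-tups k s) ⟩
      ∑[ t ∈ T ] ∑[ b ∈ F ] Within s a t b   ∎
      where open ≤-Reasoning

    across-diagonal : ∀ s a t → In s a * 𝟙 (not (S (t , a)) ∧ adj (G k) s t) ≡ Across s a t a
    across-diagonal s a t rewrite ≟-refl a = sym (*-identityʳ _)

    fibre-cuts≤across : ∑[ a ∈ F ] cut (G k) (fibre a) ≤ ∑⁴ k Across
    fibre-cuts≤across = begin
      ∑[ a ∈ F ] cut (G k) (fibre a)
        ≡⟨ ∑-comm F T _ ⟩
      ∑[ s ∈ T ] ∑[ a ∈ F ] ∑[ t ∈ T ] (In s a * 𝟙 (not (S (t , a)) ∧ adj (G k) s t))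
        ≤⟨ ∑-mono T (λ s → ∑-mono F λ a → ∑-mono T λ t →
             ≤-trans (≤-reflexive (across-diagonal s a t)) (∈⇒≤∑ (Across s a t) (∈-allFin a))) ⟩
      ∑⁴ k Across
        ∎
      where open ≤-Reasoning

    fibre-cuts+internal≤cut : ∑[ a ∈ F ] cut (G k) (fibre a) + internal ≤ cut (G (suc k)) S
    fibre-cuts+internal≤cut = begin
      ∑[ a ∈ F ] cut (G k) (fibre a) + internal ≤⟨ +-mono-≤ fibre-cuts≤across internal≤within ⟩
      ∑⁴ k Across + ∑⁴ k Within                ≡⟨ +-comm (∑⁴ k Across) _ ⟩
      ∑⁴ k Within + ∑⁴ k Across                ≡⟨ cut≡within+across ⟨
      cut (G (suc k)) S                        ∎
      where open ≤-Reasoning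

    isoperimetric-step : Isoperimetric k → n * (size (G (suc k)) S * size (G (suc k)) (not ∘ S))
                                           ≤ n ^ suc k * cut (G (suc k)) S
    isoperimetric-step iso = begin
      n * (size (G (suc k)) S * size (G (suc k)) (not ∘ S))
        ≡⟨ cong (n *_) size*size-compl≡∑⁴ ⟩
      n * ∑⁴ k (λ s a t b → In s a * Out t b)
        ≤⟨ *-monoʳ-≤ n (≤-trans (∑⁴-mono k λ s a t b → crossing-triangle (S (s , a)) (S (t , b)) (S (t , a)))
                                (≤-reflexive (∑⁴-distrib-+ k _ _))) ⟩
      n * (∑⁴ k (λ s a t b → In s a * Out t a) + ∑⁴ k (λ s a t b → In t a * Out t b))
        ≡⟨ cong (n *_) (cong₂ _+_ ∑⁴-fibrewise ∑⁴-rowwise) ⟩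
      n * (n * ∑[ a ∈ F ] (size (G k) (fibre a) * size (G k) (not ∘ fibre a)) + n ^ k * internal)
        ≤⟨ *-monoʳ-≤ n (+-monoˡ-≤ (n ^ k * internal) fibres-isoperimetric) ⟩
      n * (n ^ k * ∑[ a ∈ F ] cut (G k) (fibre a) + n ^ k * internal)
        ≡⟨ cong (n *_) (*-distribˡ-+ (n ^ k) _ internal) ⟨
      n * (n ^ k * (∑[ a ∈ F ] cut (G k) (fibre a) + internal))
        ≤⟨ *-monoʳ-≤ n (*-monoʳ-≤ (n ^ k) fibre-cuts+internal≤cut) ⟩
      n * (n ^ k * cut (G (suc k)) S)
        ≡⟨ *-assoc n (n ^ k) _ ⟨
      n ^ suc k * cut (G (suc k)) S
        ∎
      where
      open ≤-Reasoning
      fibres-isoperimetric : n * ∑[ a ∈ F ] (size (G k) (fibre a) * size (G k) (not ∘ fibre a))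
                           ≤ n ^ k * ∑[ a ∈ F ] cut (G k) (fibre a)
      fibres-isoperimetric = begin
        n * ∑[ a ∈ F ] (size (G k) (fibre a) * size (G k) (not ∘ fibre a))
          ≡⟨ ∑-distribˡ-* F n _ ⟩
        ∑[ a ∈ F ] (n * (size (G k) (fibre a) * size (G k) (not ∘ fibre a)))
          ≤⟨ ∑-mono F (iso ∘ fibre) ⟩
        ∑[ a ∈ F ] (n ^ k * cut (G k) (fibre a))
          ≡⟨ ∑-distribˡ-* F (n ^ k) _ ⟨
        n ^ k * ∑[ a ∈ F ] cut (G k) (fibre a)
          ∎

  isoperimetric : ∀ k → Isoperimetric k
  isoperimetric zero    S = subst (_≤ n ^ 0 * cut (G 0) S) (sym (single-vertex (S tt))) z≤n
    where
    single-vertex : ∀ b → n * ((𝟙 b + 0) * (𝟙 (not b) + 0)) ≡ 0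
    single-vertex true  = *-zeroʳ n
    single-vertex false = *-zeroʳ n
  isoperimetric (suc k) S = Step.isoperimetric-step k S (isoperimetric k)

theorem5p1 : (n k : ℕ) → 1 ≤ k →
    ConductanceAtLeast (selfSimilar n (completeAdj n) (matchingJ n) k) n 2
-- The hypothesis 1 ≤ k is unused: the argument also covers the one-vertex graph G⁰.
theorem5p1 n k _ S 1≤∣S∣ 2∣S∣≤∣V∣ =
  subst₂ (λ m d → n * m ≤ 2 * d) (sym (card≡size (G k) S)) (sym (boundary≡cut (G k) S))
    (conductance-from-isoperimetry n (isoperimetric k S)
      (trans (size+size-compl (G k) S) (length-tups k))
      (subst₂ (λ m N → 2 * m ≤ N) (card≡size (G k) S) (length-tups k) 2∣S∣≤∣V∣)
      (subst (1 ≤_) (card≡size (G k) S) 1≤∣S∣))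
  where
  open Isoperimetry n
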